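{- For every poset $P$, $\operatorname{iir}(P)=|P|$ if and only if the canonical inclusion representation $\{D_P[x]:x\in P\}$ of $P$ is irreducible.
   Context: All posets are finite with non-empty ground sets. An inclusion representation of $P$ is a family $\{S_x:x\in P\}$ with $x\le y$ iff $S_x\subseteq S_y$; $D_P[x]=\{u\in P:u\le x\}$. $\mathcal{S}$ is a reduction of $\mathcal{S}'$ if $|\bigcup\mathcal{S}|\le|\bigcup\mathcal{S}'|$ and $|S_x|\le|S'_x|$ for all $x$; a strict reduction if additionally $\mathcal{S}'$ is not a reduction of $\mathcal{S}$; irreducible if it has no strict reduction. $\operatorname{iir}(P)$ is the maximum size of the ground set of an irreducible inclusion representation of $P$. -}

module Defs where

open import Data.Nat using (ℕ; _≤_)
open import Data.Fin using (Fin)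
open import Data.Fin.Subset using (Subset; _⊆_; ⋃; ∣_∣)
open import Data.List using (map)
open import Data.List.Base using (allFin)
open import Data.Vec using (tabulate)
open import Data.Product using (Σ; _×_; ∃)
open import Relation.Nullary using (¬_; does)
open import Relation.Binary.PropositionalEquality using (_≡_)
open import Relation.Binary.Structures using (IsDecPartialOrder)
open import Function.Bundles using (_⇔_)
open import Level using (0ℓ; suc)

-- A finite poset whose ground set is Fin n (so |P| = n).
-- The order is decidable (automatic classically for finite posets).
record FinPoset (n : ℕ) : Set₁ where
  field
    _≼_ : Fin n → Fin n → Set
    isDecPartialOrder : IsDecPartialOrder _≡_ _≼_
  open IsDecPartialOrder isDecPartialOrder public

open FinPoset public

Family : ℕ → ℕ → Set
Family n m = Fin n → Subset m

groundSize : ∀ {n m} → Family n m → ℕ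
groundSize {n} S = ∣ ⋃ (map S (allFin n)) ∣

IsInclusionRep : ∀ {n m} → FinPoset n → Family n m → Set
IsInclusionRep P S = ∀ x y → (_≼_ P x y ⇔ (S x ⊆ S y))

IsReduction : ∀ {n m m'} → Family n m → Family n m' → Set
IsReduction S S' = (groundSize S ≤ groundSize S') × (∀ x → ∣ S x ∣ ≤ ∣ S' x ∣)

IsStrictReduction : ∀ {n m m'} → Family n m → Family n m' → Set
IsStrictReduction S S' = IsReduction S S' × ¬ IsReduction S' S

IsIrreducibleRep : ∀ {n m} → FinPoset n → Family n m → Set
IsIrreducibleRep {n} P S =
  IsInclusionRep P S ×
  (∀ (m' : ℕ) (S' : Family n m') → IsInclusionRep P S' → ¬ IsStrictReduction S' S)

IirEquals : ∀ {n} → FinPoset n → ℕ → Set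
IirEquals {n} P k =
  (Σ ℕ λ m → Σ (Family n m) λ S → IsIrreducibleRep P S × groundSize S ≡ k) ×
  (∀ (m : ℕ) (S : Family n m) → IsIrreducibleRep P S → groundSize S ≤ k)

canonicalRep : ∀ {n} → FinPoset n → Family n n
canonicalRep P x = tabulate (λ u → does (_≤?_ P u x))

{-# OPTIONS --safe #-}
-- Read a representation S over a universe of points as the bipartite graph in which the point a
-- is adjacent to x ∈ P when a ∈ S x, and let Γ A (neighbours S A) be the elements adjacent to a set
-- of points A. A deficient set A of used points, |Γ A| < |A|, can be traded for Γ A: the family
-- y ↦ (S y ∖ A) ⊎ (Γ A ∩ D[y]) over the points and a copy of P still represents P, has a smaller
-- ground set, and is a strict reduction of S unless |A ∩ S y| < |Γ A ∩ D[y]| for some y.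
-- In that case A ∖ S y is again deficient and has fewer neighbours, so descending on |Γ A|
-- always ends in a strict reduction.
-- An irreducible S thus satisfies Hall's condition. Applied to all used points it gives
-- |⋃ S| ≤ |P|; if |⋃ S| = |P|, applied to the used points outside S y it gives |S y| ≥ |D[y]|,
-- i.e. the canonical representation is a reduction of S.
module Submission where

open import Defs
  using ( FinPoset; Family; groundSize; IsInclusionRep; IsReduction; IsStrictReduction
        ; IsIrreducibleRep; IirEquals; canonicalRep )
open import Data.Bool.Base using (true)
open import Data.Fin.Base using (Fin)
open import Data.Fin.Properties using (any?)
open import Data.Fin.Subset
  using (Subset; inside; outside; _∈_; _⊆_; _∩_; _∪_; ∁; ⊥; ⊤; ⋃; ∣_∣; Nonempty)
open import Data.Fin.Subset.Properties
  using ( _∈?_; nonempty?; drop-∷-⊆; out⊆; s⊆s; ⊆-refl; ⊆-trans; ⊆-antisym; ⊆⊤; ∣p∣≤n; ∣⊤∣≡n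
        ; p⊆q⇒∣p∣≤∣q∣; p⊆p∪q; q⊆p∪q; x∈p∩q⁺; x∈p∩q⁻; p∩q⊆p; p∩q⊆q; ∣p∩q∣≤∣q∣
        ; x∈∁p⇒x∉p; x∉p⇒x∈∁p; ∣∁p∣≡n∸∣p∣
        ; ∩-comm; ∩-identityʳ; ∩-zeroˡ; ∩-zeroʳ; ∩-distribˡ-∪; ∩-distribʳ-∪ )
open import Data.List.Base using (List; []; _∷_; map; allFin)
open import Data.List.Membership.Propositional using () renaming (_∈_ to _∈ₗ_)
open import Data.List.Membership.Propositional.Properties using (∈-allFin)
open import Data.List.Relation.Unary.Any using (here; there)
open import Data.Nat.Base using (ℕ; zero; suc; _+_; _≤_; _<_; z≤n)
open import Data.Nat.Induction using (<-wellFounded)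
open import Data.Nat.Properties
  using ( _<?_; ≤-reflexive; ≤-trans; ≤-<-trans; <⇒≤; <⇒≱; ≮⇒≥; +-suc; m∸n+n≡m
        ; +-monoʳ-≤; +-monoʳ-<; +-mono-≤-<; +-cancelʳ-<; m<m+n; module ≤-Reasoning )
open import Data.Product.Base using (∃₂; _×_; _,_; proj₁; proj₂; map₁; map₂)
open import Data.Vec.Base using ([]; _∷_; here; _++_; tabulate)
open import Data.Vec.Properties using (zipWith-++; lookup∘tabulate; []=⇒lookup; lookup⇒[]=)
open import Function.Base using (_∘_)
open import Function.Bundles using (_⇔_; mk⇔; module Equivalence)
open Equivalence using (to; from)
open import Induction.WellFounded using (module All)
open import Relation.Binary.Construct.On as On using ()
open import Relation.Binary.PropositionalEquality
  using (_≡_; refl; sym; trans; cong; cong₂; module ≡-Reasoning)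
open import Relation.Nullary using (¬_; Dec; does; yes; no)
open import Relation.Nullary.Decidable using (dec-true)
open import Relation.Unary using (Pred; Decidable)

∣p∣≡∣p∩∁q∣+∣p∩q∣ : ∀ {n} (p q : Subset n) → ∣ p ∣ ≡ ∣ p ∩ ∁ q ∣ + ∣ p ∩ q ∣
∣p∣≡∣p∩∁q∣+∣p∩q∣ []            []            = refl
∣p∣≡∣p∩∁q∣+∣p∩q∣ (outside ∷ p) (_ ∷ q)       = ∣p∣≡∣p∩∁q∣+∣p∩q∣ p q
∣p∣≡∣p∩∁q∣+∣p∩q∣ (inside ∷ p)  (outside ∷ q) = cong suc (∣p∣≡∣p∩∁q∣+∣p∩q∣ p q)
∣p∣≡∣p∩∁q∣+∣p∩q∣ (inside ∷ p)  (inside ∷ q)  =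
  trans (cong suc (∣p∣≡∣p∩∁q∣+∣p∩q∣ p q)) (sym (+-suc _ _))

∣∁p∣+∣p∣≡n : ∀ {n} (p : Subset n) → ∣ ∁ p ∣ + ∣ p ∣ ≡ n
∣∁p∣+∣p∣≡n p = trans (cong (_+ ∣ p ∣) (∣∁p∣≡n∸∣p∣ p)) (m∸n+n≡m (∣p∣≤n p))

∣p++q∣≡∣p∣+∣q∣ : ∀ {m n} (p : Subset m) (q : Subset n) → ∣ p ++ q ∣ ≡ ∣ p ∣ + ∣ q ∣
∣p++q∣≡∣p∣+∣q∣ []            q = refl
∣p++q∣≡∣p∣+∣q∣ (outside ∷ p) q = ∣p++q∣≡∣p∣+∣q∣ p q
∣p++q∣≡∣p∣+∣q∣ (inside ∷ p)  q = cong suc (∣p++q∣≡∣p∣+∣q∣ p q)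

∷-⊆-∷ : ∀ {m n s s′} {p p′ : Subset m} {q q′ : Subset n} →
        s ∷ p ⊆ s′ ∷ p′ → q ⊆ q′ → s ∷ q ⊆ s′ ∷ q′
∷-⊆-∷ {s = outside}                _  q⊆q′ = out⊆ q⊆q′
∷-⊆-∷ {s = inside} {s′ = inside}   _  q⊆q′ = s⊆s q⊆q′
∷-⊆-∷ {s = inside} {s′ = outside}  sp⊆ _ with () ← sp⊆ here

++-⊆⁺ : ∀ {m n} {p p′ : Subset m} {q q′ : Subset n} → p ⊆ p′ → q ⊆ q′ → p ++ q ⊆ p′ ++ q′
++-⊆⁺ {p = []}    {[]}    _    q⊆q′ = q⊆q′
++-⊆⁺ {p = _ ∷ _} {_ ∷ _} p⊆p′ q⊆q′ = ∷-⊆-∷ p⊆p′ (++-⊆⁺ (drop-∷-⊆ p⊆p′) q⊆q′)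

++-⊆⁻ : ∀ {m n} {p p′ : Subset m} {q q′ : Subset n} → p ++ q ⊆ p′ ++ q′ → p ⊆ p′ × q ⊆ q′
++-⊆⁻ {p = []}    {[]}    pq⊆ = ⊆-refl , pq⊆
++-⊆⁻ {p = _ ∷ _} {_ ∷ _} pq⊆ = map₁ (∷-⊆-∷ pq⊆) (++-⊆⁻ (drop-∷-⊆ pq⊆))

∩-monoˡ-⊆ : ∀ {n} {p q : Subset n} (r : Subset n) → p ⊆ q → p ∩ r ⊆ q ∩ r
∩-monoˡ-⊆ r p⊆q = x∈p∩q⁺ ∘ map₁ p⊆q ∘ x∈p∩q⁻ _ r

∩-monoʳ-⊆ : ∀ {n} {q r : Subset n} (p : Subset n) → q ⊆ r → p ∩ q ⊆ p ∩ r
∩-monoʳ-⊆ p q⊆r = x∈p∩q⁺ ∘ map₂ q⊆r ∘ x∈p∩q⁻ p _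

⊆-⋃-map : ∀ {A : Set} {n} (f : A → Subset n) {xs : List A} {x} → x ∈ₗ xs → f x ⊆ ⋃ (map f xs)
⊆-⋃-map f {_ ∷ xs} (here refl)  = p⊆p∪q (⋃ (map f xs))
⊆-⋃-map f {y ∷ _}  (there x∈xs) = q⊆p∪q (f y) _ ∘ ⊆-⋃-map f x∈xs

⋃-map-∩ˡ : ∀ {A : Set} {n} (p : Subset n) (f : A → Subset n) (xs : List A) →
           ⋃ (map (λ x → p ∩ f x) xs) ≡ p ∩ ⋃ (map f xs)
⋃-map-∩ˡ p f []       = sym (∩-zeroʳ p)
⋃-map-∩ˡ p f (x ∷ xs) =
  trans (cong (p ∩ f x ∪_) (⋃-map-∩ˡ p f xs)) (sym (∩-distribˡ-∪ p (f x) _))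

⋃-map-∩ʳ : ∀ {A : Set} {n} (f : A → Subset n) (q : Subset n) (xs : List A) →
           ⋃ (map (λ x → f x ∩ q) xs) ≡ ⋃ (map f xs) ∩ q
⋃-map-∩ʳ f q []       = sym (∩-zeroˡ q)
⋃-map-∩ʳ f q (x ∷ xs) =
  trans (cong (f x ∩ q ∪_) (⋃-map-∩ʳ f q xs)) (sym (∩-distribʳ-∪ q (f x) _))

⊥++⊥ : ∀ m {n} → ⊥ {m} ++ ⊥ {n} ≡ ⊥
⊥++⊥ zero    = refl
⊥++⊥ (suc m) = cong (outside ∷_) (⊥++⊥ m)

⋃-map-++ : ∀ {A : Set} {m n} (f : A → Subset m) (g : A → Subset n) (xs : List A) →
           ⋃ (map (λ x → f x ++ g x) xs) ≡ ⋃ (map f xs) ++ ⋃ (map g xs)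
⋃-map-++ {m = m} f g []       = sym (⊥++⊥ m)
⋃-map-++         f g (x ∷ xs) =
  trans (cong ((f x ++ g x) ∪_) (⋃-map-++ f g xs))
        (zipWith-++ _ (f x) (g x) (⋃ (map f xs)) (⋃ (map g xs)))

∈-tabulate-does⇔ : ∀ {n ℓ} {Q : Pred (Fin n) ℓ} (Q? : Decidable Q) {x} →
                   x ∈ tabulate (does ∘ Q?) ⇔ Q x
∈-tabulate-does⇔ {Q = Q} Q? {x} = mk⇔
  (λ x∈ → does≡true⇒ (Q? x) (trans (sym (lookup∘tabulate (does ∘ Q?) x)) ([]=⇒lookup x∈)))
  (λ q → lookup⇒[]= x _ (trans (lookup∘tabulate (does ∘ Q?) x) (dec-true (Q? x) q)))
  where
  does≡true⇒ : (q? : Dec (Q x)) → does q? ≡ true → Q x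
  does≡true⇒ (yes q) _ = q

isReduction-trans : ∀ {n m m′ m″} {S : Family n m} {S′ : Family n m′} {S″ : Family n m″} →
                    IsReduction S S′ → IsReduction S′ S″ → IsReduction S S″
isReduction-trans (g≤g′ , s≤s′) (g′≤g″ , s′≤s″) =
  ≤-trans g≤g′ g′≤g″ , λ x → ≤-trans (s≤s′ x) (s′≤s″ x)

isStrictReduction-isReduction-trans :
  ∀ {n m m′ m″} {S : Family n m} {S′ : Family n m′} {S″ : Family n m″} →
  IsStrictReduction S S′ → IsReduction S′ S″ → IsStrictReduction S S″
isStrictReduction-isReduction-trans (S≼S′ , S′⋠S) S′≼S″ =
  isReduction-trans S≼S′ S′≼S″ , λ S″≼S → S′⋠S (isReduction-trans S′≼S″ S″≼S)

support : ∀ {n m} → Family n m → Subset m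
support {n} S = ⋃ (map S (allFin n))

⊆-support : ∀ {n m} (S : Family n m) x → S x ⊆ support S
⊆-support S x = ⊆-⋃-map S (∈-allFin x)

neighbours : ∀ {n m} → Family n m → Subset m → Subset n
neighbours S A = tabulate (λ x → does (nonempty? (A ∩ S x)))

∈neighbours⇔ : ∀ {n m} {S : Family n m} {A x} → x ∈ neighbours S A ⇔ Nonempty (A ∩ S x)
∈neighbours⇔ {S = S} {A} = ∈-tabulate-does⇔ (λ x → nonempty? (A ∩ S x))

module _ {n : ℕ} (P : FinPoset n) where
  open FinPoset P using (_≼_; _≤?_) renaming (refl to ≼-refl; trans to ≼-trans)

  private
    D : Family n n
    D = canonicalRep P

  ∈canonicalRep⇔ : ∀ {u x} → u ∈ canonicalRep P x ⇔ u ≼ x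
  ∈canonicalRep⇔ {x = x} = ∈-tabulate-does⇔ (_≤? x)

  canonicalRep-isInclusionRep : IsInclusionRep P (canonicalRep P)
  canonicalRep-isInclusionRep x y = mk⇔
    (λ x≼y {u} u∈Dx → from ∈canonicalRep⇔ (≼-trans (to ∈canonicalRep⇔ u∈Dx) x≼y))
    (λ Dx⊆Dy → to ∈canonicalRep⇔ (Dx⊆Dy (from ∈canonicalRep⇔ ≼-refl)))

  support-canonicalRep : support (canonicalRep P) ≡ ⊤
  support-canonicalRep =
    ⊆-antisym ⊆⊤ (λ {x} _ → ⊆-support D x (from ∈canonicalRep⇔ ≼-refl))

  groundSize-canonicalRep : groundSize (canonicalRep P) ≡ n
  groundSize-canonicalRep = trans (cong ∣_∣ support-canonicalRep) (∣⊤∣≡n n)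

  HasStrictReduction : ∀ {m} → Family n m → Set
  HasStrictReduction S = ∃₂ λ m′ (S′ : Family n m′) → IsInclusionRep P S′ × IsStrictReduction S′ S

  exchange : ∀ {m} → Family n m → Subset m → Family n (m + n)
  exchange S A y = (S y ∩ ∁ A) ++ (neighbours S A ∩ D y)

  ∣exchange∣ : ∀ {m} (S : Family n m) A y →
               ∣ exchange S A y ∣ ≡ ∣ S y ∩ ∁ A ∣ + ∣ neighbours S A ∩ D y ∣
  ∣exchange∣ S A y = ∣p++q∣≡∣p∣+∣q∣ (S y ∩ ∁ A) _

  support-exchange : ∀ {m} (S : Family n m) A →
                     support (exchange S A) ≡ (support S ∩ ∁ A) ++ neighbours S A
  support-exchange S A = begin
    support (exchange S A)
      ≡⟨ ⋃-map-++ (λ y → S y ∩ ∁ A) (λ y → Γ ∩ D y) (allFin n) ⟩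
    support (λ y → S y ∩ ∁ A) ++ support (λ y → Γ ∩ D y)
      ≡⟨ cong₂ _++_ (⋃-map-∩ʳ S (∁ A) (allFin n)) (⋃-map-∩ˡ Γ D (allFin n)) ⟩
    (support S ∩ ∁ A) ++ (Γ ∩ support D)
      ≡⟨ cong (λ U → (support S ∩ ∁ A) ++ (Γ ∩ U)) support-canonicalRep ⟩
    (support S ∩ ∁ A) ++ (Γ ∩ ⊤)
      ≡⟨ cong ((support S ∩ ∁ A) ++_) (∩-identityʳ Γ) ⟩
    (support S ∩ ∁ A) ++ Γ
      ∎
    where
    open ≡-Reasoning
    Γ : Subset n
    Γ = neighbours S A

  groundSize-exchange : ∀ {m} (S : Family n m) A →
                        groundSize (exchange S A) ≡ ∣ support S ∩ ∁ A ∣ + ∣ neighbours S A ∣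
  groundSize-exchange S A =
    trans (cong ∣_∣ (support-exchange S A)) (∣p++q∣≡∣p∣+∣q∣ (support S ∩ ∁ A) _)

  exchange-isStrictReduction :
    ∀ {m} {S : Family n m} {A} → A ⊆ support S → ∣ neighbours S A ∣ < ∣ A ∣ →
    (∀ y → ∣ neighbours S A ∩ D y ∣ ≤ ∣ A ∩ S y ∣) → IsStrictReduction (exchange S A) S
  exchange-isStrictReduction {S = S} {A} A⊆S Γ<A Γy≤Ay =
    (<⇒≤ ground< , size≤) , λ (S≤ex , _) → <⇒≱ ground< S≤ex
    where
    open ≤-Reasoning
    A⊆S∩A : A ⊆ support S ∩ A
    A⊆S∩A a∈A = x∈p∩q⁺ (A⊆S a∈A , a∈A)
    ground< : groundSize (exchange S A) < groundSize S
    ground< = begin-strict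
      groundSize (exchange S A)                 ≡⟨ groundSize-exchange S A ⟩
      ∣ support S ∩ ∁ A ∣ + ∣ neighbours S A ∣  <⟨ +-monoʳ-< _ Γ<A ⟩
      ∣ support S ∩ ∁ A ∣ + ∣ A ∣               ≤⟨ +-monoʳ-≤ _ (p⊆q⇒∣p∣≤∣q∣ A⊆S∩A) ⟩
      ∣ support S ∩ ∁ A ∣ + ∣ support S ∩ A ∣   ≡⟨ ∣p∣≡∣p∩∁q∣+∣p∩q∣ (support S) A ⟨
      groundSize S                              ∎
    size≤ : ∀ y → ∣ exchange S A y ∣ ≤ ∣ S y ∣
    size≤ y = begin
      ∣ exchange S A y ∣                         ≡⟨ ∣exchange∣ S A y ⟩
      ∣ S y ∩ ∁ A ∣ + ∣ neighbours S A ∩ D y ∣   ≤⟨ +-monoʳ-≤ _ (Γy≤Ay y) ⟩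
      ∣ S y ∩ ∁ A ∣ + ∣ A ∩ S y ∣                ≡⟨ cong (∣ S y ∩ ∁ A ∣ +_) ∣A∩Sy∣≡∣Sy∩A∣ ⟩
      ∣ S y ∩ ∁ A ∣ + ∣ S y ∩ A ∣                ≡⟨ ∣p∣≡∣p∩∁q∣+∣p∩q∣ (S y) A ⟨
      ∣ S y ∣                                    ∎
      where
      ∣A∩Sy∣≡∣Sy∩A∣ : ∣ A ∩ S y ∣ ≡ ∣ S y ∩ A ∣
      ∣A∩Sy∣≡∣Sy∩A∣ = cong ∣_∣ (∩-comm A (S y))

  module _ {m} {S : Family n m} (rep : IsInclusionRep P S) where

    private
      mono : ∀ {x y} → x ≼ y → S x ⊆ S y
      mono {x} {y} = to (rep x y)

    exchange-isInclusionRep : ∀ A → IsInclusionRep P (exchange S A)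
    exchange-isInclusionRep A y z = mk⇔ mono′ reflect′
      where
      mono′ : y ≼ z → exchange S A y ⊆ exchange S A z
      mono′ y≼z = ++-⊆⁺ (∩-monoˡ-⊆ (∁ A) (mono y≼z))
                        (∩-monoʳ-⊆ (neighbours S A) (to (canonicalRep-isInclusionRep y z) y≼z))
      reflect′ : exchange S A y ⊆ exchange S A z → y ≼ z
      reflect′ ex⊆ = from (rep y z) Sy⊆Sz
        where
        kept : S y ∩ ∁ A ⊆ S z ∩ ∁ A
        kept = proj₁ (++-⊆⁻ ex⊆)
        added : neighbours S A ∩ D y ⊆ neighbours S A ∩ D z
        added = proj₂ (++-⊆⁻ ex⊆)
        Sy⊆Sz : S y ⊆ S z
        Sy⊆Sz {a} a∈Sy with a ∈? A
        ... | no  a∉A = proj₁ (x∈p∩q⁻ _ _ (kept (x∈p∩q⁺ (a∈Sy , x∉p⇒x∈∁p a∉A))))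
        ... | yes a∈A = mono y≼z a∈Sy
          where
          y∈ΓA : y ∈ neighbours S A
          y∈ΓA = from ∈neighbours⇔ (a , x∈p∩q⁺ (a∈A , a∈Sy))
          y≼z : y ≼ z
          y≼z = to ∈canonicalRep⇔
                  (proj₂ (x∈p∩q⁻ _ _ (added (x∈p∩q⁺ (y∈ΓA , from ∈canonicalRep⇔ ≼-refl)))))

    neighbours-∩∁ : ∀ A y → neighbours S (A ∩ ∁ (S y)) ⊆ neighbours S A ∩ ∁ (D y)
    neighbours-∩∁ A y {x} x∈ΓB with to ∈neighbours⇔ x∈ΓB
    ... | a , a∈B∩Sx with x∈p∩q⁻ _ _ a∈B∩Sx
    ... | a∈B , a∈Sx with x∈p∩q⁻ _ _ a∈B
    ... | a∈A , a∈∁Sy = x∈p∩q⁺ (from ∈neighbours⇔ (a , x∈p∩q⁺ (a∈A , a∈Sx)) , x∉p⇒x∈∁p x∉Dy)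
      where
      x∉Dy : ¬ x ∈ D y
      x∉Dy x∈Dy = x∈∁p⇒x∉p a∈∁Sy (mono (to ∈canonicalRep⇔ x∈Dy) a∈Sx)

    deficient-∩∁ : ∀ {A} y → ∣ neighbours S A ∣ < ∣ A ∣ → ∣ A ∩ S y ∣ < ∣ neighbours S A ∩ D y ∣ →
                   ∣ neighbours S (A ∩ ∁ (S y)) ∣ < ∣ neighbours S A ∣ ×
                   ∣ neighbours S (A ∩ ∁ (S y)) ∣ < ∣ A ∩ ∁ (S y) ∣
    deficient-∩∁ {A} y Γ<A Ay<Γy = ≤-<-trans ΓB≤Γ∖Dy Γ∖Dy<Γ , ≤-<-trans ΓB≤Γ∖Dy Γ∖Dy<B
      where
      open ≤-Reasoning
      Γ : Subset n
      Γ = neighbours S A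
      ΓB≤Γ∖Dy : ∣ neighbours S (A ∩ ∁ (S y)) ∣ ≤ ∣ Γ ∩ ∁ (D y) ∣
      ΓB≤Γ∖Dy = p⊆q⇒∣p∣≤∣q∣ (neighbours-∩∁ A y)
      Γ∖Dy<Γ : ∣ Γ ∩ ∁ (D y) ∣ < ∣ Γ ∣
      Γ∖Dy<Γ = begin-strict
        ∣ Γ ∩ ∁ (D y) ∣                   <⟨ m<m+n _ (≤-<-trans z≤n Ay<Γy) ⟩
        ∣ Γ ∩ ∁ (D y) ∣ + ∣ Γ ∩ D y ∣     ≡⟨ ∣p∣≡∣p∩∁q∣+∣p∩q∣ Γ (D y) ⟨
        ∣ Γ ∣                             ∎
      Γ∖Dy<B : ∣ Γ ∩ ∁ (D y) ∣ < ∣ A ∩ ∁ (S y) ∣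
      Γ∖Dy<B = +-cancelʳ-< _ _ _ (begin-strict
        ∣ Γ ∩ ∁ (D y) ∣ + ∣ Γ ∩ D y ∣     ≡⟨ ∣p∣≡∣p∩∁q∣+∣p∩q∣ Γ (D y) ⟨
        ∣ Γ ∣                             <⟨ Γ<A ⟩
        ∣ A ∣                             ≡⟨ ∣p∣≡∣p∩∁q∣+∣p∩q∣ A (S y) ⟩
        ∣ A ∩ ∁ (S y) ∣ + ∣ A ∩ S y ∣     <⟨ +-monoʳ-< _ Ay<Γy ⟩
        ∣ A ∩ ∁ (S y) ∣ + ∣ Γ ∩ D y ∣     ∎)

    deficient⇒hasStrictReduction :
      ∀ A → A ⊆ support S → ∣ neighbours S A ∣ < ∣ A ∣ → HasStrictReduction S
    deficient⇒hasStrictReduction =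
      All.wfRec (On.wellFounded (∣_∣ ∘ neighbours S) <-wellFounded) _ Goal step
      where
      Goal : Subset m → Set
      Goal A = A ⊆ support S → ∣ neighbours S A ∣ < ∣ A ∣ → HasStrictReduction S
      step : ∀ A → (∀ {B} → ∣ neighbours S B ∣ < ∣ neighbours S A ∣ → Goal B) → Goal A
      step A ih A⊆S Γ<A with any? (λ y → ∣ A ∩ S y ∣ <? ∣ neighbours S A ∩ D y ∣)
      ... | yes (y , Ay<Γy) =
        let (ΓB<ΓA , ΓB<B) = deficient-∩∁ y Γ<A Ay<Γy in
        ih ΓB<ΓA (⊆-trans (p∩q⊆p A _) A⊆S) ΓB<B
      ... | no ¬∃ = m + n , exchange S A , exchange-isInclusionRep A ,
                    exchange-isStrictReduction A⊆S Γ<A (λ y → ≮⇒≥ (¬∃ ∘ (y ,_)))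

  module _ {m} {S : Family n m} (irr : IsIrreducibleRep P S) where

    private
      rep : IsInclusionRep P S
      rep = proj₁ irr
      ¬hasStrictReduction : ¬ HasStrictReduction S
      ¬hasStrictReduction (_ , S′ , rep′ , S′≺S) = proj₂ irr _ S′ rep′ S′≺S

    irreducible⇒groundSize≤ : groundSize S ≤ n
    irreducible⇒groundSize≤ = ≮⇒≥ λ n<ground →
      ¬hasStrictReduction (deficient⇒hasStrictReduction rep (support S) ⊆-refl
        (≤-<-trans (∣p∣≤n (neighbours S (support S))) n<ground))

    irreducible⇒canonicalRep-isReduction : groundSize S ≡ n → IsReduction (canonicalRep P) S
    irreducible⇒canonicalRep-isReduction ground≡n =
      ≤-reflexive (trans groundSize-canonicalRep (sym ground≡n)) , λ y → ≮⇒≥ λ Sy<Dy →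
        ¬hasStrictReduction (deficient⇒hasStrictReduction rep (support S ∩ ∁ (S y)) (p∩q⊆p _ _)
          (+-cancelʳ-< _ _ _ (deficiency y Sy<Dy)))
      where
      open ≤-Reasoning
      deficiency : ∀ y → ∣ S y ∣ < ∣ D y ∣ → let A = support S ∩ ∁ (S y) in
                   ∣ neighbours S A ∣ + ∣ S y ∣ < ∣ A ∣ + ∣ S y ∣
      deficiency y Sy<Dy = begin-strict
        ∣ neighbours S A ∣ + ∣ S y ∣     <⟨ +-mono-≤-< (p⊆q⇒∣p∣≤∣q∣ ΓA⊆∁Dy) Sy<Dy ⟩
        ∣ ∁ (D y) ∣ + ∣ D y ∣            ≡⟨ ∣∁p∣+∣p∣≡n (D y) ⟩
        n                                ≡⟨ ground≡n ⟨
        ∣ support S ∣                    ≡⟨ ∣p∣≡∣p∩∁q∣+∣p∩q∣ (support S) (S y) ⟩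
        ∣ A ∣ + ∣ support S ∩ S y ∣      ≤⟨ +-monoʳ-≤ _ (∣p∩q∣≤∣q∣ (support S) (S y)) ⟩
        ∣ A ∣ + ∣ S y ∣                  ∎
        where
        A : Subset m
        A = support S ∩ ∁ (S y)
        ΓA⊆∁Dy : neighbours S A ⊆ ∁ (D y)
        ΓA⊆∁Dy = p∩q⊆q _ _ ∘ neighbours-∩∁ rep (support S) y

corollary2p4 : ∀ (n : ℕ) (P : FinPoset (suc n)) →
    IirEquals P (suc n) ⇔ IsIrreducibleRep P (canonicalRep P)
corollary2p4 n P = mk⇔ necessary sufficient
  where
  necessary : IirEquals P (suc n) → IsIrreducibleRep P (canonicalRep P)
  necessary ((_ , S , irr , ground≡n) , _) =
    canonicalRep-isInclusionRep P , λ _ S′ rep′ S′≺C →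
      proj₂ irr _ S′ rep′ (isStrictReduction-isReduction-trans {S = S′} {S″ = S} S′≺C
                            (irreducible⇒canonicalRep-isReduction P irr ground≡n))
  sufficient : IsIrreducibleRep P (canonicalRep P) → IirEquals P (suc n)
  sufficient irrC =
    (suc n , canonicalRep P , irrC , groundSize-canonicalRep P) ,
    λ _ S irr → irreducible⇒groundSize≤ P irr
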